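{- Let $k\ge 1$, $0\le t\le k$ and $n\ge 1$ be integers. Then \[ \sum_{j=0}^{n-1}\frac{t+1}{(k+1)(n-1-j)+t+1}\binom{(k+1)(n-1-j)+t+1}{n-1-j}\cdot\frac{t+1}{j+1}\binom{(k+1)j+k-t-1}{j}=\frac{t+1}{(k+1)n+t+1}\binom{(k+1)n+t+1}{n}. \] -}

module Defs where

open import Data.Nat using (ℕ; zero; suc; _∸_)
open import Data.Rational using (ℚ; 0ℚ; _+_)

sumℚ : ℕ → (ℕ → ℚ) → ℚ
sumℚ zero    f = 0ℚ
sumℚ (suc n) f = sumℚ n f + f n

module Submission where

-- Write R k n r = r/((k+1)n+r) · C((k+1)n+r, n) for the Raney numbers with
-- parameter k+1.  The first factor of the summand is R k (n-1-j) (t+1), the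
-- right-hand side is R k n (t+1), and the second factor is the window sum
-- W k t j = R k j (k-t) + … + R k j k.  The identity thus reads
--   Σ_{j<n} R k (n-1-j) (t+1) · W k t j = R k n (t+1),
-- which follows by exchanging the double sum, applying the convolution
-- Σ_j R k j r · R k (m-j) s = R k m (r+s) to each inner sum, and recognising
-- the unrolled recurrence of R in its last argument.

module Raney where

  open import Data.Nat using (ℕ; zero; suc; _+_; _*_; _∸_; _≤_; s≤s; NonZero)
  open import Data.Nat.Tactic.RingSolver using (solve-∀)
  open import Data.Nat.Properties
  open import Data.Nat.Combinatorics using (_C_; nC1≡n; nCk+nC[k+1]≡[n+1]C[k+1]; k>n⇒nCk≡0)
  open import Data.Sum using (inj₁; inj₂)
  open import Data.Product using (_,_)
  open import Function using (_∘_)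
  open import Relation.Binary.PropositionalEquality
  open ≡-Reasoning

  sumℕ : ℕ → (ℕ → ℕ) → ℕ
  sumℕ zero    f = 0
  sumℕ (suc n) f = sumℕ n f + f n

  sumℕ-cong : ∀ n {f g : ℕ → ℕ} → (∀ i → f i ≡ g i) → sumℕ n f ≡ sumℕ n g
  sumℕ-cong zero    f≡g = refl
  sumℕ-cong (suc n) f≡g = cong₂ _+_ (sumℕ-cong n f≡g) (f≡g n)

  sumℕ-zero : ∀ n → sumℕ n (λ _ → 0) ≡ 0
  sumℕ-zero zero    = refl
  sumℕ-zero (suc n) = trans (+-identityʳ _) (sumℕ-zero n)

  sumℕ-+ : ∀ n (f g : ℕ → ℕ) → sumℕ n (λ i → f i + g i) ≡ sumℕ n f + sumℕ n g
  sumℕ-+ zero    f g = refl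
  sumℕ-+ (suc n) f g = trans (cong (_+ (f n + g n)) (sumℕ-+ n f g)) (regroup (sumℕ n f) (sumℕ n g) (f n) (g n))
    where
    regroup : ∀ a b c d → a + b + (c + d) ≡ a + c + (b + d)
    regroup = solve-∀

  sumℕ-*ˡ : ∀ n c (f : ℕ → ℕ) → c * sumℕ n f ≡ sumℕ n (λ i → c * f i)
  sumℕ-*ˡ zero    c f = *-zeroʳ c
  sumℕ-*ˡ (suc n) c f = trans (*-distribˡ-+ c (sumℕ n f) (f n)) (cong (_+ c * f n) (sumℕ-*ˡ n c f))

  sumℕ-head : ∀ n (f : ℕ → ℕ) → sumℕ (suc n) f ≡ f 0 + sumℕ n (λ i → f (suc i))
  sumℕ-head zero    f = sym (+-identityʳ (f 0))
  sumℕ-head (suc n) f = trans (cong (_+ f (suc n)) (sumℕ-head n f)) (+-assoc (f 0) _ _)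

  sumℕ-swap : ∀ m n (F : ℕ → ℕ → ℕ) →
    sumℕ m (λ j → sumℕ n (λ i → F i j)) ≡ sumℕ n (λ i → sumℕ m (λ j → F i j))
  sumℕ-swap zero    n F = sym (sumℕ-zero n)
  sumℕ-swap (suc m) n F =
    trans (cong (_+ sumℕ n (λ i → F i m)) (sumℕ-swap m n F))
          (sym (sumℕ-+ n (λ i → sumℕ m (λ j → F i j)) (λ i → F i m)))

  C-absorb : ∀ n k → suc k * (suc n C suc k) ≡ suc n * (n C k)
  C-absorb zero    zero    = refl
  C-absorb zero    (suc k) = *-zeroʳ (suc (suc k))
  C-absorb (suc n) zero    = trans (*-identityˡ _) (trans (nC1≡n (suc (suc n))) (sym (*-identityʳ _)))
  C-absorb (suc n) (suc k) = begin
    suc (suc k) * (suc (suc n) C suc (suc k))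
      ≡⟨ cong (suc (suc k) *_) (sym (nCk+nC[k+1]≡[n+1]C[k+1] (suc n) (suc k))) ⟩
    suc (suc k) * (X + Y)                          ≡⟨ expand (suc k) X Y ⟩
    (suc k * X + X) + suc (suc k) * Y              ≡⟨ cong₂ (λ a b → a + X + b) (C-absorb n k) (C-absorb n (suc k)) ⟩
    (suc n * (n C k) + X) + suc n * (n C suc k)    ≡⟨ collect (suc n) (n C k) (n C suc k) X ⟩
    suc n * (n C k + n C suc k) + X                ≡⟨ cong (λ z → suc n * z + X) (nCk+nC[k+1]≡[n+1]C[k+1] n k) ⟩
    suc n * X + X                                  ≡⟨ +-comm (suc n * X) X ⟩
    suc (suc n) * X                                ∎
    where
    X Y : ℕ
    X = suc n C suc k
    Y = suc n C suc (suc k)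
    expand : ∀ a x y → suc a * (x + y) ≡ (a * x + x) + suc a * y
    expand = solve-∀
    collect : ∀ a b c x → (a * b + x) + a * c ≡ a * (b + c) + x
    collect = solve-∀

  C-absorb-low : ∀ {m} k q → k + q ≡ m → suc k * (m C suc k) ≡ q * (m C k)
  C-absorb-low k q refl = +-cancelʳ-≡ (suc k * Y) (suc k * X) (q * Y) (begin
    suc k * X + suc k * Y        ≡⟨ sym (*-distribˡ-+ (suc k) X Y) ⟩
    suc k * (X + Y)              ≡⟨ cong (suc k *_) (+-comm X Y) ⟩
    suc k * (Y + X)              ≡⟨ cong (suc k *_) (nCk+nC[k+1]≡[n+1]C[k+1] (k + q) k) ⟩
    suc k * (suc (k + q) C suc k) ≡⟨ C-absorb (k + q) k ⟩
    suc (k + q) * Y              ≡⟨ split k q Y ⟩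
    q * Y + suc k * Y            ∎)
    where
    X Y : ℕ
    X = (k + q) C suc k
    Y = (k + q) C k
    split : ∀ k q y → suc (k + q) * y ≡ q * y + suc k * y
    split = solve-∀

  C-absorb-top : ∀ {n} j m → j + m ≡ n → suc n * (n C j) ≡ suc m * (suc n C j)
  C-absorb-top j m refl = begin
    suc (j + m) * ((j + m) C j)     ≡⟨ sym (C-absorb (j + m) j) ⟩
    suc j * (suc (j + m) C suc j)   ≡⟨ C-absorb-low j (suc m) (+-suc j m) ⟩
    suc m * (suc (j + m) C j)       ∎

  C-shift : ∀ k j → k * ((suc k * suc j) C suc j) ≡ suc k * ((suc k * suc j ∸ 1) C suc j)
  C-shift zero    j = sym (trans (*-identityˡ _) (k>n⇒nCk≡0 (s≤s (≤-reflexive (+-identityʳ j)))))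
  C-shift (suc k) j = *-cancelˡ-≡ _ _ (suc j) (begin
    suc j * (suc k * C[N])          ≡⟨ rearrange (suc j) (suc k) C[N] ⟩
    (suc k * suc j) * C[N]          ≡⟨ sym (C-absorb-top (suc j) (j + k * suc j) (sym (+-suc j _))) ⟩
    N * C[N-1]                      ≡⟨ sym (rearrange (suc j) (suc (suc k)) C[N-1]) ⟩
    suc j * (suc (suc k) * C[N-1])  ∎)
    where
    N C[N] C[N-1] : ℕ
    N = suc (suc k) * suc j
    C[N] = N C suc j
    C[N-1] = (N ∸ 1) C suc j
    rearrange : ∀ a b c → a * (b * c) ≡ (b * a) * c
    rearrange = solve-∀

  -- The Raney numbers R k n r = r/((k+1)n+r)·C((k+1)n+r, n), through their
  -- recurrence in r (R k n 0 vanishes for n ≥ 1).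
  R : ℕ → ℕ → ℕ → ℕ
  R k zero    r       = 1
  R k (suc n) zero    = 0
  R k (suc n) (suc r) = R k (suc n) r + R k n (suc r + k)

  raney-unroll : ∀ k m s → R k (suc m) s ≡ sumℕ s (λ i → R k m (suc i + k))
  raney-unroll k m zero    = refl
  raney-unroll k m (suc s) = cong (_+ R k m (suc s + k)) (raney-unroll k m s)

  raney-convolution : ∀ k n r s → sumℕ (suc n) (λ j → R k j r * R k (n ∸ j) s) ≡ R k n (r + s)
  raney-convolution k zero    r       s = refl
  raney-convolution k (suc n) zero    s = begin
    sumℕ (suc (suc n)) (λ j → R k j 0 * R k (suc n ∸ j) s) ≡⟨ sumℕ-head (suc n) _ ⟩
    1 * R k (suc n) s + sumℕ (suc n) (λ _ → 0)              ≡⟨ cong₂ _+_ (*-identityˡ _) (sumℕ-zero (suc n)) ⟩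
    R k (suc n) s + 0                                       ≡⟨ +-identityʳ _ ⟩
    R k (suc n) s                                           ∎
  raney-convolution k (suc n) (suc r) s = begin
    sumℕ (suc (suc n)) (λ j → R k j (suc r) * R k (suc n ∸ j) s) ≡⟨ sumℕ-head (suc n) _ ⟩
    R k 0 r * R k (suc n) s + sumℕ (suc n) (λ i → (A i + B i) * R k (n ∸ i) s)
      ≡⟨ cong (R k 0 r * R k (suc n) s +_) split ⟩
    R k 0 r * R k (suc n) s + (sumℕ (suc n) (λ i → A i * R k (n ∸ i) s) + sumℕ (suc n) (λ i → B i * R k (n ∸ i) s))
      ≡⟨ sym (+-assoc (R k 0 r * R k (suc n) s) _ _) ⟩
    (R k 0 r * R k (suc n) s + sumℕ (suc n) (λ i → A i * R k (n ∸ i) s)) + sumℕ (suc n) (λ i → B i * R k (n ∸ i) s)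
      ≡⟨ cong (_+ sumℕ (suc n) (λ i → B i * R k (n ∸ i) s)) (sumℕ-head (suc n) _) ⟨
    sumℕ (suc (suc n)) (λ j → R k j r * R k (suc n ∸ j) s) + sumℕ (suc n) (λ i → B i * R k (n ∸ i) s)
      ≡⟨ cong₂ _+_ (raney-convolution k (suc n) r s) (raney-convolution k n (suc r + k) s) ⟩
    R k (suc n) (r + s) + R k n (suc r + k + s)
      ≡⟨ cong (λ x → R k (suc n) (r + s) + R k n x) (shift r k s) ⟩
    R k (suc n) (suc r + s) ∎
    where
    A B : ℕ → ℕ
    A i = R k (suc i) r
    B i = R k i (suc r + k)
    split : sumℕ (suc n) (λ i → (A i + B i) * R k (n ∸ i) s)
          ≡ sumℕ (suc n) (λ i → A i * R k (n ∸ i) s) + sumℕ (suc n) (λ i → B i * R k (n ∸ i) s)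
    split = trans (sumℕ-cong (suc n) (λ i → *-distribʳ-+ (R k (n ∸ i) s) (A i) (B i))) (sumℕ-+ (suc n) _ _)
    shift : ∀ r k s → suc r + k + s ≡ suc (r + s) + k
    shift = solve-∀

  -- "R k n r has the closed form at size N":  N · R k n r = r · C(N, n).  It is
  -- meant for N = (k+1)n + r; keeping N abstract lets it be transported along
  -- rewritings of that expression.
  ClosedAt : ℕ → ℕ → ℕ → ℕ → Set
  ClosedAt k n r N = N * R k n r ≡ r * (N C n)

  -- Multiplying by
  -- M = (k+1)(n+1)+r turns the goal into a polynomial identity in
  -- X = C(M, n+1) and Y = C(M, n), valid thanks to (n+1)·X = q·Y, where q = M-n.
  raney-closed-step : ∀ k n r → let M = suc k * suc n + r in
    ClosedAt k (suc n) r M → ClosedAt k n (suc r + k) M → ClosedAt k (suc n) (suc r) (suc M)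
  raney-closed-step k n r closed₁ closed₂ = begin
    suc M * (R₁ + R₂)        ≡⟨ *-cancelˡ-≡ _ _ M (+-cancelʳ-≡ (suc k * (q * Y)) _ _ key) ⟩
    suc r * (Y + X)          ≡⟨ cong (suc r *_) (nCk+nC[k+1]≡[n+1]C[k+1] M n) ⟩
    suc r * (suc M C suc n)  ∎
    where
    M q R₁ R₂ X Y : ℕ
    M = suc k * suc n + r
    q = k * suc n + suc r
    R₁ = R k (suc n) r
    R₂ = R k n (suc r + k)
    X = M C suc n
    Y = M C n
    lower : suc n * X ≡ q * Y
    lower = C-absorb-low n q (size k n r)
      where
      size : ∀ k n r → n + (k * suc n + suc r) ≡ suc k * suc n + r
      size = solve-∀
    distribute : ∀ m m' a b → m * (m' * (a + b)) ≡ m' * (m * a + m * b)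
    distribute = solve-∀
    polynomial : ∀ k n r X Y → let M = suc k * suc n + r ; q = k * suc n + suc r in
      suc M * (r * X + (suc r + k) * Y) + suc k * (suc n * X) ≡ M * (suc r * (Y + X)) + suc k * (q * Y)
    polynomial = solve-∀
    key : M * (suc M * (R₁ + R₂)) + suc k * (q * Y) ≡ M * (suc r * (Y + X)) + suc k * (q * Y)
    key = begin
      M * (suc M * (R₁ + R₂)) + suc k * (q * Y)
        ≡⟨ cong₂ _+_ (distribute M (suc M) R₁ R₂) (cong (suc k *_) (sym lower)) ⟩
      suc M * (M * R₁ + M * R₂) + suc k * (suc n * X)
        ≡⟨ cong (λ z → suc M * z + suc k * (suc n * X)) (cong₂ _+_ closed₁ closed₂) ⟩
      suc M * (r * X + (suc r + k) * Y) + suc k * (suc n * X)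
        ≡⟨ polynomial k n r X Y ⟩
      M * (suc r * (Y + X)) + suc k * (q * Y) ∎

  raney-closed : ∀ k n r → ClosedAt k n r (suc k * n + r)
  raney-closed k zero    r       = subst (λ m → ClosedAt k 0 r (m + r)) (sym (*-zeroʳ (suc k))) refl
  raney-closed k (suc n) zero    = *-zeroʳ (suc k * suc n + 0)
  raney-closed k (suc n) (suc r) =
    subst (ClosedAt k (suc n) (suc r)) (sym (+-suc (suc k * suc n) r))
      (raney-closed-step k n r (raney-closed k (suc n) r)
        (subst (ClosedAt k n (suc r + k)) (size k n r) (raney-closed k n (suc r + k))))
    where
    size : ∀ k n r → suc k * n + (suc r + k) ≡ suc k * suc n + r
    size = solve-∀

  raney-window : ∀ k j t u → u + t ≡ k →
    suc j * sumℕ t (λ i → R k j (suc u + i)) ≡ t * ((suc k * j + u) C j)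
  raney-window k j zero    u _    = *-zeroʳ (suc j)
  raney-window _ j (suc t) u refl = *-cancelˡ-≡ _ _ N (begin
    N * (suc j * sumℕ (suc t) (λ i → R k j (suc u + i)))
      ≡⟨ cong (λ z → N * (suc j * z)) peel ⟩
    N * (suc j * (R₀ + S))                ≡⟨ distribute N (suc j) R₀ S ⟩
    suc j * (N * R₀) + N * (suc j * S)    ≡⟨ cong₂ (λ x y → suc j * x + N * y) (raney-closed k j (suc u)) higher ⟩
    suc j * (suc u * Z) + N * (t * Z)     ≡⟨ polynomial t u j Z ⟩
    suc t * (suc a * Z)                   ≡⟨ cong (suc t *_) (sym top) ⟩
    suc t * (N * W)                       ≡⟨ rearrange (suc t) N W ⟩
    N * (suc t * W)                       ∎)
    where
    k a N Z W R₀ S : ℕ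
    k = u + suc t
    a = k * j + u
    N = suc k * j + suc u
    Z = N C j
    W = (suc k * j + u) C j
    R₀ = R k j (suc u)
    S = sumℕ t (λ i → R k j (suc (suc u) + i))
    instance
      N-nonZero : NonZero N
      N-nonZero = subst NonZero (sym (+-suc (suc k * j) u)) _
    peel : sumℕ (suc t) (λ i → R k j (suc u + i)) ≡ R₀ + S
    peel = trans (sumℕ-head t _)
                 (cong₂ _+_ (cong (R k j ∘ suc) (+-identityʳ u)) (sumℕ-cong t (λ i → cong (R k j ∘ suc) (+-suc u i))))
    higher : suc j * S ≡ t * Z
    higher = raney-window k j t (suc u) (sym (+-suc u t))
    top : N * W ≡ suc a * Z
    top = begin
      N * W                                 ≡⟨ cong (_* W) (+-suc (suc k * j) u) ⟩
      suc (suc k * j + u) * W               ≡⟨ C-absorb-top j a (sym (+-assoc j (k * j) u)) ⟩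
      suc a * (suc (suc k * j + u) C j)     ≡⟨ cong (λ m → suc a * (m C j)) (sym (+-suc (suc k * j) u)) ⟩
      suc a * Z                             ∎
    distribute : ∀ n m x y → n * (m * (x + y)) ≡ m * (n * x) + n * (m * y)
    distribute = solve-∀
    polynomial : ∀ t u j z → let k = u + suc t in
      suc j * (suc u * z) + (suc k * j + suc u) * (t * z) ≡ suc t * (suc (k * j + u) * z)
    polynomial = solve-∀
    rearrange : ∀ a n w → a * (n * w) ≡ n * (a * w)
    rearrange = solve-∀

  Window : ℕ → ℕ → ℕ → ℕ
  Window k t j = sumℕ (suc t) (λ i → R k j (k ∸ t + i))

  window-below : ∀ t u j → let k = suc t + u in
    suc j * Window k t j ≡ suc t * (((suc k * j + k) ∸ suc t) C j)
  window-below t u j = begin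
    suc j * sumℕ (suc t) (λ i → R k j (k ∸ t + i))
      ≡⟨ cong (λ d → suc j * sumℕ (suc t) (λ i → R k j (d + i))) start ⟩
    suc j * sumℕ (suc t) (λ i → R k j (suc u + i))  ≡⟨ raney-window k j (suc t) u (+-comm u (suc t)) ⟩
    suc t * ((suc k * j + u) C j)                    ≡⟨ cong (λ m → suc t * (m C j)) (sym top) ⟩
    suc t * (((suc k * j + k) ∸ suc t) C j)          ∎
    where
    k : ℕ
    k = suc t + u
    start : k ∸ t ≡ suc u
    start = trans (cong (_∸ t) (sym (+-suc t u))) (m+n∸m≡n t (suc u))
    reorder : ∀ x t u → x + (suc t + u) ≡ x + u + suc t
    reorder = solve-∀
    top : (suc k * j + k) ∸ suc t ≡ suc k * j + u
    top = trans (cong (_∸ suc t) (reorder (suc k * j) t u)) (m+n∸n≡m (suc k * j + u) (suc t))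

  with-zeroth-term : ∀ k j →
    suc j * R k j 0 + k * ((suc k * j + 0) C j) ≡ suc k * (((suc k * j + k) ∸ suc k) C j)
  with-zeroth-term k zero    = refl
  with-zeroth-term k (suc j) = begin
    suc (suc j) * 0 + k * ((suc k * suc j + 0) C suc j)  ≡⟨ cong₂ (λ a m → a + k * (m C suc j)) (*-zeroʳ (suc (suc j))) (+-identityʳ (suc k * suc j)) ⟩
    k * ((suc k * suc j) C suc j)                         ≡⟨ C-shift k j ⟩
    suc k * ((suc k * suc j ∸ 1) C suc j)                 ≡⟨ cong (λ m → suc k * (m C suc j)) (sym (m+n∸n≡m (j + k * suc j) k)) ⟩
    suc k * (((suc k * suc j + k) ∸ suc k) C suc j)       ∎

  window-full : ∀ k j → suc j * Window k k j ≡ suc k * (((suc k * j + k) ∸ suc k) C j)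
  window-full k j = begin
    suc j * Window k k j                          ≡⟨ cong (suc j *_) split ⟩
    suc j * (R k j 0 + T)                         ≡⟨ *-distribˡ-+ (suc j) (R k j 0) T ⟩
    suc j * R k j 0 + suc j * T                   ≡⟨ cong (suc j * R k j 0 +_) (raney-window k j k 0 refl) ⟩
    suc j * R k j 0 + k * ((suc k * j + 0) C j)   ≡⟨ with-zeroth-term k j ⟩
    suc k * (((suc k * j + k) ∸ suc k) C j)       ∎
    where
    T : ℕ
    T = sumℕ k (λ i → R k j (suc i))
    split : Window k k j ≡ R k j 0 + T
    split = trans (sumℕ-cong (suc k) (λ i → cong (λ d → R k j (d + i)) (n∸n≡0 k))) (sumℕ-head k (R k j))

  window-closed : ∀ k t j → t ≤ k → suc j * Window k t j ≡ suc t * (((suc k * j + k) ∸ suc t) C j)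
  window-closed k t j t≤k with m≤n⇒m<n∨m≡n t≤k
  ... | inj₂ refl = window-full k j
  ... | inj₁ t<k with m≤n⇒∃[o]m+o≡n t<k
  ...   | u , refl = window-below t u j

  raney-identity : ∀ k t m → t ≤ k →
    sumℕ (suc m) (λ j → R k (m ∸ j) (suc t) * Window k t j) ≡ R k (suc m) (suc t)
  raney-identity k t m t≤k = begin
    sumℕ (suc m) (λ j → R k (m ∸ j) (suc t) * Window k t j)
      ≡⟨ sumℕ-cong (suc m) (λ j → sumℕ-*ˡ (suc t) (R k (m ∸ j) (suc t)) (λ i → R k j (k ∸ t + i))) ⟩
    sumℕ (suc m) (λ j → sumℕ (suc t) (λ i → F i j))  ≡⟨ sumℕ-swap (suc m) (suc t) F ⟩
    sumℕ (suc t) (λ i → sumℕ (suc m) (λ j → F i j))  ≡⟨ sumℕ-cong (suc t) convolve ⟩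
    sumℕ (suc t) (λ i → R k m (suc i + k))          ≡⟨ sym (raney-unroll k m (suc t)) ⟩
    R k (suc m) (suc t)                             ∎
    where
    F : ℕ → ℕ → ℕ
    F i j = R k (m ∸ j) (suc t) * R k j (k ∸ t + i)
    reorder : ∀ d i t → d + i + suc t ≡ suc i + (d + t)
    reorder = solve-∀
    index : ∀ i → k ∸ t + i + suc t ≡ suc i + k
    index i = trans (reorder (k ∸ t) i t) (cong (suc i +_) (m∸n+n≡m t≤k))
    convolve : ∀ i → sumℕ (suc m) (λ j → F i j) ≡ R k m (suc i + k)
    convolve i = begin
      sumℕ (suc m) (λ j → F i j)
        ≡⟨ sumℕ-cong (suc m) (λ j → *-comm (R k (m ∸ j) (suc t)) (R k j (k ∸ t + i))) ⟩
      sumℕ (suc m) (λ j → R k j (k ∸ t + i) * R k (m ∸ j) (suc t)) ≡⟨ raney-convolution k m (k ∸ t + i) (suc t) ⟩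
      R k m (k ∸ t + i + suc t)                                    ≡⟨ cong (R k m) (index i) ⟩
      R k m (suc i + k)                                            ∎

open import Defs
open import Data.Nat using (ℕ; suc; _∸_; _≤_) renaming (_+_ to _+ℕ_; _*_ to _*ℕ_)
open import Data.Nat.Combinatorics using (_C_)
open import Data.Integer using (+_)
open import Data.Rational using (ℚ; _/_; _*_)
open import Relation.Binary.PropositionalEquality using (_≡_)

open import Data.Nat using (zero)
import Data.Nat.Properties as ℕ
open import Data.Nat.Tactic.RingSolver using (solve-∀)
import Data.Integer as ℤ
import Data.Integer.Properties as ℤ
open import Data.Rational using (_+_; toℚᵘ)
open import Data.Rational.Properties using (toℚᵘ-injective; toℚᵘ-fromℚᵘ; toℚᵘ-homo-*; toℚᵘ-homo-+)
import Data.Rational.Unnormalised as ℚᵘ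
import Data.Rational.Unnormalised.Properties as ℚᵘ
open import Relation.Binary.PropositionalEquality using (refl; sym; trans; cong; cong₂; module ≡-Reasoning)

open Raney using (sumℕ; R; raney-closed; Window; window-closed; raney-identity)

ι : ℕ → ℚ
ι a = + a / 1

-- Cross-multiplied form of (a/(b+1))·c = d, as ℚᵘ.*≡* expects it.
cross-* : ∀ a b c d → suc b *ℕ d ≡ a *ℕ c → + a ℤ.* + c ℤ.* + 1 ≡ + d ℤ.* (+ suc b ℤ.* + 1)
cross-* a b c d eq = begin
  + a ℤ.* + c ℤ.* + 1       ≡⟨ ℤ.*-identityʳ _ ⟩
  + a ℤ.* + c               ≡⟨ ℤ.pos-* a c ⟨
  + (a *ℕ c)                ≡⟨ cong +_ (trans (sym eq) (ℕ.*-comm (suc b) d)) ⟩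
  + (d *ℕ suc b)            ≡⟨ ℤ.pos-* d (suc b) ⟩
  + d ℤ.* + suc b           ≡⟨ cong (+ d ℤ.*_) (ℤ.*-identityʳ (+ suc b)) ⟨
  + d ℤ.* (+ suc b ℤ.* + 1) ∎
  where open ≡-Reasoning

cross-+ : ∀ a c → (+ a ℤ.* + 1 ℤ.+ + c ℤ.* + 1) ℤ.* + 1 ≡ + (a +ℕ c) ℤ.* (+ 1 ℤ.* + 1)
cross-+ a c = begin
  (+ a ℤ.* + 1 ℤ.+ + c ℤ.* + 1) ℤ.* + 1 ≡⟨ ℤ.*-identityʳ _ ⟩
  + a ℤ.* + 1 ℤ.+ + c ℤ.* + 1           ≡⟨ cong₂ ℤ._+_ (ℤ.*-identityʳ (+ a)) (ℤ.*-identityʳ (+ c)) ⟩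
  + a ℤ.+ + c                           ≡⟨ ℤ.pos-+ a c ⟨
  + (a +ℕ c)                            ≡⟨ ℤ.*-identityʳ _ ⟨
  + (a +ℕ c) ℤ.* (+ 1 ℤ.* + 1)          ∎
  where open ≡-Reasoning

fraction-* : ∀ a b c d → suc b *ℕ d ≡ a *ℕ c → (+ a / suc b) * ι c ≡ ι d
fraction-* a b c d eq = toℚᵘ-injective (begin
  toℚᵘ ((+ a / suc b) * ι c)             ≈⟨ toℚᵘ-homo-* (+ a / suc b) (ι c) ⟩
  toℚᵘ (+ a / suc b) ℚᵘ.* toℚᵘ (ι c)     ≈⟨ ℚᵘ.*-cong (toℚᵘ-fromℚᵘ (ℚᵘ.mkℚᵘ (+ a) b)) (toℚᵘ-fromℚᵘ (ℚᵘ.mkℚᵘ (+ c) 0)) ⟩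
  ℚᵘ.mkℚᵘ (+ a) b ℚᵘ.* ℚᵘ.mkℚᵘ (+ c) 0  ≈⟨ ℚᵘ.*≡* (cross-* a b c d eq) ⟩
  ℚᵘ.mkℚᵘ (+ d) 0                        ≈⟨ toℚᵘ-fromℚᵘ (ℚᵘ.mkℚᵘ (+ d) 0) ⟨
  toℚᵘ (ι d)                             ∎)
  where open ℚᵘ.≃-Reasoning

ι-* : ∀ a c → ι a * ι c ≡ ι (a *ℕ c)
ι-* a c = fraction-* a 0 c (a *ℕ c) (ℕ.+-identityʳ (a *ℕ c))

ι-+ : ∀ a c → ι a + ι c ≡ ι (a +ℕ c)
ι-+ a c = toℚᵘ-injective (begin
  toℚᵘ (ι a + ι c)                       ≈⟨ toℚᵘ-homo-+ (ι a) (ι c) ⟩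
  toℚᵘ (ι a) ℚᵘ.+ toℚᵘ (ι c)             ≈⟨ ℚᵘ.+-cong (toℚᵘ-fromℚᵘ (ℚᵘ.mkℚᵘ (+ a) 0)) (toℚᵘ-fromℚᵘ (ℚᵘ.mkℚᵘ (+ c) 0)) ⟩
  ℚᵘ.mkℚᵘ (+ a) 0 ℚᵘ.+ ℚᵘ.mkℚᵘ (+ c) 0  ≈⟨ ℚᵘ.*≡* (cross-+ a c) ⟩
  ℚᵘ.mkℚᵘ (+ (a +ℕ c)) 0                 ≈⟨ toℚᵘ-fromℚᵘ (ℚᵘ.mkℚᵘ (+ (a +ℕ c)) 0) ⟨
  toℚᵘ (ι (a +ℕ c))                      ∎)
  where open ℚᵘ.≃-Reasoning

sumℚ-cong : ∀ n {f g : ℕ → ℚ} → (∀ j → f j ≡ g j) → sumℚ n f ≡ sumℚ n g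
sumℚ-cong zero    f≡g = refl
sumℚ-cong (suc n) f≡g = cong₂ _+_ (sumℚ-cong n f≡g) (f≡g n)

sumℚ-ι : ∀ n (g : ℕ → ℕ) → sumℚ n (λ j → ι (g j)) ≡ ι (sumℕ n g)
sumℚ-ι zero    g = refl
sumℚ-ι (suc n) g = trans (cong (_+ ι (g n)) (sumℚ-ι n g)) (ι-+ (sumℕ n g) (g n))

raneyℚ : ℕ → ℕ → ℕ → ℚ
raneyℚ k t n = (+ (t +ℕ 1) / suc ((k +ℕ 1) *ℕ n +ℕ t)) * ι (((k +ℕ 1) *ℕ n +ℕ t +ℕ 1) C n)

windowℚ : ℕ → ℕ → ℕ → ℚ
windowℚ k t j = (+ (t +ℕ 1) / suc j) * ι ((((k +ℕ 1) *ℕ j +ℕ k) ∸ (t +ℕ 1)) C j)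

raneyℚ≡R : ∀ k t n → raneyℚ k t n ≡ ι (R k n (suc t))
raneyℚ≡R k t n = fraction-* (t +ℕ 1) ((k +ℕ 1) *ℕ n +ℕ t) _ (R k n (suc t)) (begin
  suc ((k +ℕ 1) *ℕ n +ℕ t) *ℕ R k n (suc t)    ≡⟨ cong (_*ℕ R k n (suc t)) (size₁ k t n) ⟩
  (suc k *ℕ n +ℕ suc t) *ℕ R k n (suc t)       ≡⟨ raney-closed k n (suc t) ⟩
  suc t *ℕ ((suc k *ℕ n +ℕ suc t) C n)         ≡⟨ cong₂ (λ a m → a *ℕ (m C n)) (ℕ.+-comm 1 t) (sym (size₂ k t n)) ⟩
  (t +ℕ 1) *ℕ (((k +ℕ 1) *ℕ n +ℕ t +ℕ 1) C n)  ∎)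
  where
  open ≡-Reasoning
  size₁ : ∀ k t n → suc ((k +ℕ 1) *ℕ n +ℕ t) ≡ suc k *ℕ n +ℕ suc t
  size₁ = solve-∀
  size₂ : ∀ k t n → (k +ℕ 1) *ℕ n +ℕ t +ℕ 1 ≡ suc k *ℕ n +ℕ suc t
  size₂ = solve-∀

windowℚ≡Window : ∀ k t j → t ≤ k → windowℚ k t j ≡ ι (Window k t j)
windowℚ≡Window k t j t≤k = fraction-* (t +ℕ 1) j _ (Window k t j) (begin
  suc j *ℕ Window k t j                                 ≡⟨ window-closed k t j t≤k ⟩
  suc t *ℕ (((suc k *ℕ j +ℕ k) ∸ suc t) C j)            ≡⟨ cong₂ (λ a m → a *ℕ ((m ∸ a) C j)) (ℕ.+-comm 1 t) (size k j) ⟩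
  (t +ℕ 1) *ℕ ((((k +ℕ 1) *ℕ j +ℕ k) ∸ (t +ℕ 1)) C j)  ∎)
  where
  open ≡-Reasoning
  size : ∀ k j → suc k *ℕ j +ℕ k ≡ (k +ℕ 1) *ℕ j +ℕ k
  size = solve-∀

-- For n = m+1 the summand is raneyℚ k t (m-j) · windowℚ k t j; the case n = 0
-- is excluded by 1 ≤ n, while 1 ≤ k is not used.
proposition5p10 : (k t n : ℕ) → 1 ≤ k → t ≤ k → 1 ≤ n →
    sumℚ n (λ j →
      ((+ (t +ℕ 1) / suc ((k +ℕ 1) *ℕ (n ∸ 1 ∸ j) +ℕ t))
        * (+ (((k +ℕ 1) *ℕ (n ∸ 1 ∸ j) +ℕ t +ℕ 1) C (n ∸ 1 ∸ j)) / 1))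
      * ((+ (t +ℕ 1) / suc j)
        * (+ ((((k +ℕ 1) *ℕ j +ℕ k) ∸ (t +ℕ 1)) C j) / 1)))
    ≡ (+ (t +ℕ 1) / suc ((k +ℕ 1) *ℕ n +ℕ t))
      * (+ (((k +ℕ 1) *ℕ n +ℕ t +ℕ 1) C n) / 1)
proposition5p10 k t (suc m) _ t≤k _ = begin
  sumℚ (suc m) (λ j → raneyℚ k t (m ∸ j) * windowℚ k t j)
    ≡⟨ sumℚ-cong (suc m) (λ j → cong₂ _*_ (raneyℚ≡R k t (m ∸ j)) (windowℚ≡Window k t j t≤k)) ⟩
  sumℚ (suc m) (λ j → ι (R k (m ∸ j) (suc t)) * ι (Window k t j))
    ≡⟨ sumℚ-cong (suc m) (λ j → ι-* (R k (m ∸ j) (suc t)) (Window k t j)) ⟩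
  sumℚ (suc m) (λ j → ι (R k (m ∸ j) (suc t) *ℕ Window k t j))
    ≡⟨ sumℚ-ι (suc m) (λ j → R k (m ∸ j) (suc t) *ℕ Window k t j) ⟩
  ι (sumℕ (suc m) (λ j → R k (m ∸ j) (suc t) *ℕ Window k t j))
    ≡⟨ cong ι (raney-identity k t m t≤k) ⟩
  ι (R k (suc m) (suc t))
    ≡⟨ raneyℚ≡R k t (suc m) ⟨
  raneyℚ k t (suc m)
    ∎
  where open ≡-Reasoning
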